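{- Let $q$ be an odd prime power, $n\ge 2$, let $G$ be the graph representation of a coding scheme over $GF(q)$ on vertices $p_1,\dots,p_n$, and let $H$ be a subgraph of $G$ obtained by deleting edges (keeping all vertices). Then $H$ is decodable if and only if each connected component of $H$ is neither a bipartite graph nor an isolated vertex.
   Context: Coding scheme: encodings of packets $p_1,\dots,p_n\in GF(q)^\ell$, each $p_j$ or $p_j+p_k$ ($j\ne k$). Graph representation: vertices $p_1,\dots,p_n$, an edge joining $p_j,p_k$ per encoding $p_j+p_k$, a loop at $p_j$ per encoding $p_j$ (multigraph). $H$ is decodable if the encodings of its edges determine $p_1,\dots,p_n$ uniquely. A graph is bipartite if its vertex set splits into two sets with every edge having exactly one endpoint in each; in particular a graph with a loop is not bipartite. An isolated vertex is a vertex with no incident edges (including loops). -}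

module Defs where

open import Level using (0ℓ)
open import Data.Nat using (ℕ; suc; _^_; _≥_)
open import Data.Nat.Primality using (Prime)
open import Data.Nat.DivMod using (_%_)
open import Data.Fin using (Fin)
open import Data.Fin.Properties as FinP using ()
open import Data.Bool using (Bool)
open import Data.List using (List)
open import Data.List.Membership.Propositional using (_∈_)
open import Data.Product using (Σ; ∃; ∃-syntax; _×_; _,_)
open import Data.Sum using (_⊎_)
open import Data.Empty using (⊥)
open import Relation.Nullary using (¬_)
open import Relation.Binary.PropositionalEquality using (_≡_; _≢_)
import Relation.Binary.PropositionalEquality as ≡
open import Relation.Binary.Construct.Closure.ReflexiveTransitive using (Star)
open import Algebra.Bundles using (CommutativeRing)
open import Function.Bundles using (Inverse)

IsField : CommutativeRing 0ℓ 0ℓ → Set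
IsField R = (¬ (0# ≈ 1#)) × (∀ x → ¬ (x ≈ 0#) → ∃[ y ] (x * y ≈ 1#))
  where open CommutativeRing R

HasCardinality : CommutativeRing 0ℓ 0ℓ → ℕ → Set
HasCardinality R q = Inverse (CommutativeRing.setoid R) (≡.setoid (Fin q))

IsPrimePower : ℕ → Set
IsPrimePower q = ∃[ p ] ∃[ k ] (Prime p × k ≥ 1 × q ≡ p ^ k)

IsOdd : ℕ → Set
IsOdd q = q % 2 ≡ 1

IsGF : CommutativeRing 0ℓ 0ℓ → ℕ → Set
IsGF R q = IsField R × HasCardinality R q

-- Coding schemes and their graph representation on vertices Fin n
-- (vertex j stands for packet p_j).

-- An encoding: either a single packet p_j (a loop at j) or a sum
-- p_j + p_k with j ≠ k (an edge joining j and k).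
data Encoding (n : ℕ) : Set where
  single : Fin n → Encoding n
  pair   : (j k : Fin n) → j ≢ k → Encoding n

-- A coding scheme / its graph representation: a multiset (list) of encodings.
Scheme : ℕ → Set
Scheme n = List (Encoding n)

Incident : ∀ {n} → Encoding n → Fin n → Set
Incident (single j)   v = j ≡ v
Incident (pair j k _) v = j ≡ v ⊎ k ≡ v

Adjacent : ∀ {n} → Scheme n → Fin n → Fin n → Set
Adjacent {n} H u v = ∃[ e ] (e ∈ H × Incident e u × Incident e v)

Connected : ∀ {n} → Scheme n → Fin n → Fin n → Set
Connected H = Star (Adjacent H)

Properly : ∀ {n} → (Fin n → Bool) → Encoding n → Set
Properly c (single j)   = ⊥
Properly c (pair j k _) = c j ≢ c k

ComponentBipartite : ∀ {n} → Scheme n → Fin n → Set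
ComponentBipartite {n} H v =
  ∃[ c ] (∀ e → e ∈ H → (∃[ u ] (Connected H v u × Incident e u)) → Properly c e)

ComponentIsolated : ∀ {n} → Scheme n → Fin n → Set
ComponentIsolated {n} H v =
  (∀ u → Connected H v u → u ≡ v) × (∀ e → e ∈ H → ¬ Incident e v)

module _ (R : CommutativeRing 0ℓ 0ℓ) where
  open CommutativeRing R

  Packet : ℕ → Set
  Packet ℓ = Fin ℓ → Carrier

  _≋_ : ∀ {ℓ} → Packet ℓ → Packet ℓ → Set
  x ≋ y = ∀ i → x i ≈ y i

  encode : ∀ {n ℓ} → (Fin n → Packet ℓ) → Encoding n → Packet ℓ
  encode p (single j)   = p j
  encode p (pair j k _) = λ i → p j i + p k i

  Decodable : ∀ {n} → ℕ → Scheme n → Set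
  Decodable {n} ℓ H = ∀ (p p' : Fin n → Packet ℓ) →
    (∀ e → e ∈ H → encode p e ≋ encode p' e) → ∀ j → p j ≋ p' j

module Submission where

-- Decodability is injectivity of the linear encoding map, i.e. triviality of
-- its kernel. A kernel vector x has x k = - x j along every edge and x j = 0 at
-- every loop, so x u = ± x v throughout the component of v. If x v ≠ 0,
-- colouring that component by whether x u = x v is a proper 2-colouring: a
-- monochromatic edge or a loop would force x v + x v = 0 or x v = 0, and 2 is
-- invertible because q is odd. Conversely a 2-colouring of a component gives
-- the kernel vector ±1 on it and 0 elsewhere. An isolated vertex is a
-- bipartite component.

open import Defs
open import Level using (0ℓ)
open import Data.Nat using (ℕ; zero; suc; _≥_)
import Data.Nat.Properties as ℕ
open import Data.Nat.DivMod using (_%_)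
open import Data.Fin using (Fin; zero; suc; punchIn; punchOut)
open import Data.Fin.Properties using (suc-injective; punchIn-injective; punchInᵢ≢i; punchIn-punchOut; 0≢1+n; sequence; inj⇒≟)
open import Data.Bool using (Bool; true; false)
open import Data.Empty using (⊥-elim)
open import Data.Product using (Σ; ∃-syntax; _×_; _,_; proj₁; proj₂)
open import Data.Sum using (_⊎_; inj₁; inj₂)
open import Data.List.Membership.Propositional using (_∈_)
open import Data.List.Relation.Binary.Sublist.Propositional using (_⊆_)
open import Relation.Binary.PropositionalEquality as ≡ using (_≡_; _≢_; refl; cong)
open import Relation.Binary.Construct.Closure.ReflexiveTransitive using (ε; _◅_; _◅◅_)
open import Relation.Nullary using (¬_; Dec; yes; no; does)
open import Relation.Nullary.Decidable using (¬¬-excluded-middle)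
open import Relation.Nullary.Negation using (¬¬-Monad)
open import Effect.Monad using (RawMonad)
open import Function using (_∘_)
open import Function.Bundles using (Inverse; Equivalence; _⇔_; mk⇔)
open import Function.Properties.Equivalence using () renaming (trans to ⇔-trans)
open import Function.Properties.Inverse using (Inverse⇒Injection)
open import Algebra.Bundles using (CommutativeRing)
import Algebra.Properties.AbelianGroup as AbelianGroupProperties
import Algebra.Properties.CommutativeSemigroup as CommutativeSemigroupProperties

module _ {m} (g : Fin (suc (suc m)) → Fin (suc (suc m)))
         (g-involutive : ∀ i → g (g i) ≡ i) (g-fixedPointFree : ∀ i → g i ≢ i)
         (a : Fin (suc m)) (g0≡a : g zero ≡ suc a) where

  private
    embed : Fin m → Fin (suc (suc m))
    embed i = suc (punchIn a i)

    embed-injective : ∀ {i j} → embed i ≡ embed j → i ≡ j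
    embed-injective = punchIn-injective a _ _ ∘ suc-injective

    embed-onto : ∀ x → x ≢ zero → x ≢ suc a → Σ (Fin m) λ y → embed y ≡ x
    embed-onto zero    x≢0 _   = ⊥-elim (x≢0 refl)
    embed-onto (suc x) _   x≢a = punchOut a≢x , cong suc (punchIn-punchOut a≢x)
      where a≢x = x≢a ∘ cong suc ∘ ≡.sym

    g-transpose : ∀ {x y} → g x ≡ y → x ≡ g y
    g-transpose {x} eq = ≡.trans (≡.sym (g-involutive x)) (cong g eq)

    g-embed≢0 : ∀ i → g (embed i) ≢ zero
    g-embed≢0 i eq = punchInᵢ≢i a i (suc-injective (≡.trans (g-transpose eq) g0≡a))

    g-embed≢a : ∀ i → g (embed i) ≢ suc a
    g-embed≢a i eq = 0≢1+n (≡.sym (begin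
      embed i       ≡⟨ g-transpose eq ⟩
      g (suc a)     ≡⟨ cong g g0≡a ⟨
      g (g zero)    ≡⟨ g-involutive zero ⟩
      zero          ∎))
      where open ≡.≡-Reasoning

  -- The restriction of g to the complement of its 2-cycle {0, a + 1}.
  restrict : Fin m → Fin m
  restrict i = proj₁ (embed-onto (g (embed i)) (g-embed≢0 i) (g-embed≢a i))

  private
    embed-restrict : ∀ i → embed (restrict i) ≡ g (embed i)
    embed-restrict i = proj₂ (embed-onto (g (embed i)) (g-embed≢0 i) (g-embed≢a i))

  restrict-involutive : ∀ i → restrict (restrict i) ≡ i
  restrict-involutive i = embed-injective (begin
    embed (restrict (restrict i)) ≡⟨ embed-restrict (restrict i) ⟩
    g (embed (restrict i))        ≡⟨ cong g (embed-restrict i) ⟩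
    g (g (embed i))               ≡⟨ g-involutive (embed i) ⟩
    embed i                       ∎)
    where open ≡.≡-Reasoning

  restrict-fixedPointFree : ∀ i → restrict i ≢ i
  restrict-fixedPointFree i eq =
    g-fixedPointFree (embed i) (≡.trans (≡.sym (embed-restrict i)) (cong embed eq))

fixedPointFreeInvolution⇒even : ∀ m (g : Fin m → Fin m) →
  (∀ i → g (g i) ≡ i) → (∀ i → g i ≢ i) → m % 2 ≡ 0
fixedPointFreeInvolution⇒even zero          g _   _   = refl
fixedPointFreeInvolution⇒even (suc zero)    g _   fpf with g zero in g0
... | zero = ⊥-elim (fpf zero g0)
fixedPointFreeInvolution⇒even (suc (suc m)) g inv fpf with g zero in g0
... | zero  = ⊥-elim (fpf zero g0)
... | suc a = fixedPointFreeInvolution⇒even m (restrict g inv fpf a g0)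
                (restrict-involutive g inv fpf a g0) (restrict-fixedPointFree g inv fpf a g0)

ComponentIsolated⇒ComponentBipartite : ∀ {n} (H : Scheme n) v →
  ComponentIsolated H v → ComponentBipartite H v
ComponentIsolated⇒ComponentBipartite H v (only-v , no-edge) =
  (λ _ → true) , λ e e∈H (u , v⇝u , e∋u) →
    ⊥-elim (no-edge e e∈H (≡.subst (Incident e) (only-v u v⇝u) e∋u))

module _ (R : CommutativeRing 0ℓ 0ℓ) where
  open CommutativeRing R hiding (zero) renaming (refl to ≈-refl)
  open import Relation.Binary.Reasoning.Setoid setoid
  open AbelianGroupProperties +-abelianGroup
    using (ε⁻¹≈ε; ⁻¹-involutive; ⁻¹-∙-comm; inverseʳ-unique; x∙y⁻¹≈ε⇒x≈y; x≈y⇒x∙y⁻¹≈ε)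
  open CommutativeSemigroupProperties +-commutativeSemigroup using (interchange)

  evaluate : ∀ {n} → (Fin n → Carrier) → Encoding n → Carrier
  evaluate x (single j)   = x j
  evaluate x (pair j k _) = x j + x k

  InKernel : ∀ {n} → Scheme n → (Fin n → Carrier) → Set
  InKernel H x = ∀ e → e ∈ H → evaluate x e ≈ 0#

  TrivialKernel : ∀ {n} → Scheme n → Set
  TrivialKernel H = ∀ x → InKernel H x → ∀ v → x v ≈ 0#

  encode-coordinate : ∀ {n ℓ} (p : Fin n → Packet R ℓ) e i →
    encode R p e i ≡ evaluate (λ u → p u i) e
  encode-coordinate p (single j)   i = refl
  encode-coordinate p (pair j k _) i = refl

  evaluate-zero : ∀ {n} (e : Encoding n) → evaluate (λ _ → 0#) e ≈ 0#
  evaluate-zero (single j)   = ≈-refl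
  evaluate-zero (pair j k _) = +-identityʳ 0#

  evaluate-difference : ∀ {n} (x y : Fin n → Carrier) e →
    evaluate (λ u → x u - y u) e ≈ evaluate x e - evaluate y e
  evaluate-difference x y (single j)   = ≈-refl
  evaluate-difference x y (pair j k _) = begin
    (x j - y j) + (x k - y k)   ≈⟨ interchange _ _ _ _ ⟩
    (x j + x k) + (- y j - y k) ≈⟨ +-congˡ (⁻¹-∙-comm _ _) ⟩
    (x j + x k) - (y j + y k)   ∎

  Decodable⇔TrivialKernel : ∀ {n} ℓ (H : Scheme n) →
    Decodable R (suc ℓ) H ⇔ TrivialKernel H
  Decodable⇔TrivialKernel ℓ H = mk⇔ decodable⇒trivial trivial⇒decodable
    where
    decodable⇒trivial : Decodable R (suc ℓ) H → TrivialKernel H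
    decodable⇒trivial decode x x∈ker v = decode (λ u _ → x u) (λ _ _ → 0#) agree v zero
      where
      agree : ∀ e → e ∈ H → _≋_ R (encode R (λ u _ → x u) e) (encode R (λ _ _ → 0#) e)
      agree e e∈H i = begin
        encode R (λ u _ → x u) e i ≡⟨ encode-coordinate _ e i ⟩
        evaluate x e               ≈⟨ x∈ker e e∈H ⟩
        0#                         ≈⟨ evaluate-zero e ⟨
        evaluate (λ _ → 0#) e      ≡⟨ encode-coordinate _ e i ⟨
        encode R (λ _ _ → 0#) e i  ∎

    trivial⇒decodable : TrivialKernel H → Decodable R (suc ℓ) H
    trivial⇒decodable trivial p p' agree v i =
      x∙y⁻¹≈ε⇒x≈y _ _ (trivial difference difference∈ker v)
      where
      difference : Fin _ → Carrier
      difference u = p u i - p' u i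

      difference∈ker : InKernel H difference
      difference∈ker e e∈H = begin
        evaluate difference e
          ≈⟨ evaluate-difference _ _ e ⟩
        evaluate (λ u → p u i) e - evaluate (λ u → p' u i) e
          ≡⟨ ≡.cong₂ _-_ (encode-coordinate p e i) (encode-coordinate p' e i) ⟨
        encode R p e i - encode R p' e i
          ≈⟨ x≈y⇒x∙y⁻¹≈ε (agree e e∈H i) ⟩
        0# ∎

  infix 4 _≈±_
  _≈±_ : Carrier → Carrier → Set
  x ≈± y = x ≈ y ⊎ x ≈ - y

  ≈±-trans : ∀ {x y z} → x ≈± y → y ≈± z → x ≈± z
  ≈±-trans (inj₁ x≈y)  (inj₁ y≈z)  = inj₁ (trans x≈y y≈z)
  ≈±-trans (inj₁ x≈y)  (inj₂ y≈-z) = inj₂ (trans x≈y y≈-z)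
  ≈±-trans (inj₂ x≈-y) (inj₁ y≈z)  = inj₂ (trans x≈-y (-‿cong y≈z))
  ≈±-trans (inj₂ x≈-y) (inj₂ y≈-z) = inj₁ (trans x≈-y (trans (-‿cong y≈-z) (⁻¹-involutive _)))

  ≈±-zero : ∀ {x y} → x ≈± y → x ≈ 0# → y ≈ 0#
  ≈±-zero (inj₁ x≈y)  x≈0 = trans (sym x≈y) x≈0
  ≈±-zero {y = y} (inj₂ x≈-y) x≈0 = begin
    y      ≈⟨ ⁻¹-involutive y ⟨
    - - y  ≈⟨ -‿cong (trans (sym x≈-y) x≈0) ⟩
    - 0#   ≈⟨ ε⁻¹≈ε ⟩
    0#     ∎

  module _ {n} {H : Scheme n} {x : Fin n → Carrier} (x∈ker : InKernel H x) where

    Adjacent⇒≈± : ∀ {u w} → Adjacent H u w → x w ≈± x u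
    Adjacent⇒≈± (single j   , _   , refl      , refl)      = inj₁ ≈-refl
    Adjacent⇒≈± (pair j k _ , _   , inj₁ refl , inj₁ refl) = inj₁ ≈-refl
    Adjacent⇒≈± (pair j k _ , _   , inj₂ refl , inj₂ refl) = inj₁ ≈-refl
    Adjacent⇒≈± (pair j k _ , e∈H , inj₁ refl , inj₂ refl) =
      inj₂ (inverseʳ-unique _ _ (x∈ker _ e∈H))
    Adjacent⇒≈± (pair j k _ , e∈H , inj₂ refl , inj₁ refl) =
      inj₂ (inverseʳ-unique _ _ (trans (+-comm _ _) (x∈ker _ e∈H)))

    Connected⇒≈± : ∀ {u w} → Connected H u w → x w ≈± x u
    Connected⇒≈± ε           = inj₁ ≈-refl
    Connected⇒≈± (u~m ◅ m⇝w) = ≈±-trans (Connected⇒≈± m⇝w) (Adjacent⇒≈± u~m)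

    module _ (_≟_ : ∀ a b → Dec (a ≈ b)) (2-torsionFree : ∀ a → a + a ≈ 0# → a ≈ 0#)
             {v} (xv≉0 : ¬ x v ≈ 0#) where

      private
        colour : Fin n → Bool
        colour u = does (x u ≟ x v)

        ≉⇒≈- : ∀ {a b} → a ≈± b → ¬ a ≈ b → a ≈ - b
        ≉⇒≈- (inj₁ a≈b)  a≉b = ⊥-elim (a≉b a≈b)
        ≉⇒≈- (inj₂ a≈-b) _   = a≈-b

        sameColour⇒≈ : ∀ {j k} → x j ≈± x v → x k ≈± x v → colour j ≡ colour k → x j ≈ x k
        sameColour⇒≈ {j} {k} j± k± same with x j ≟ x v | x k ≟ x v
        ... | yes j≈v | yes k≈v = trans j≈v (sym k≈v)
        ... | no  j≉v | no  k≉v = trans (≉⇒≈- j± j≉v) (sym (≉⇒≈- k± k≉v))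
        sameColour⇒≈ j± k± () | yes _ | no _
        sameColour⇒≈ j± k± () | no _  | yes _

      nonzeroKernelVector⇒ComponentBipartite : ComponentBipartite H v
      nonzeroKernelVector⇒ComponentBipartite = colour , proper
        where
        proper : ∀ e → e ∈ H → (∃[ u ] (Connected H v u × Incident e u)) → Properly colour e
        proper (single j) e∈H (u , v⇝j , refl) =
          xv≉0 (≈±-zero (Connected⇒≈± v⇝j) (x∈ker _ e∈H))
        proper e@(pair j k _) e∈H (u , v⇝u , e∋u) same =
          xv≉0 (≈±-zero (Connected⇒≈± v⇝j) (2-torsionFree (x j) (begin
            x j + x j ≈⟨ +-congˡ (sameColour⇒≈ (Connected⇒≈± v⇝j) (Connected⇒≈± v⇝k) same) ⟩
            x j + x k ≈⟨ x∈ker e e∈H ⟩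
            0#        ∎)))
          where
          v⇝j v⇝k : Connected H v _
          v⇝j = v⇝u ◅◅ ((e , e∈H , e∋u , inj₁ refl) ◅ ε)
          v⇝k = v⇝u ◅◅ ((e , e∈H , e∋u , inj₂ refl) ◅ ε)

  signed : Bool → Carrier
  signed true  = 1#
  signed false = - 1#

  signed-≈±1 : ∀ b → signed b ≈± 1#
  signed-≈±1 true  = inj₁ ≈-refl
  signed-≈±1 false = inj₂ ≈-refl

  signed-opposite : ∀ {b b'} → b ≢ b' → signed b + signed b' ≈ 0#
  signed-opposite {true}  {true}  b≢b' = ⊥-elim (b≢b' refl)
  signed-opposite {false} {false} b≢b' = ⊥-elim (b≢b' refl)
  signed-opposite {true}  {false} _    = -‿inverseʳ 1#
  signed-opposite {false} {true}  _    = -‿inverseˡ 1#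

  -- Connectivity need not be decidable, but as the goal is ⊥ we may assume it is.
  ComponentBipartite⇒¬TrivialKernel : ¬ 1# ≈ 0# → ∀ {n} (H : Scheme n) v →
    ComponentBipartite H v → ¬ TrivialKernel H
  ComponentBipartite⇒¬TrivialKernel 1≉0 {n} H v (colour , proper) trivial =
    sequence (RawMonad.rawApplicative ¬¬-Monad) (λ _ → ¬¬-excluded-middle) contradiction
    where
    contradiction : ¬ (∀ u → Dec (Connected H v u))
    contradiction v⇝? = nonzero (v⇝? v) (trivial x x∈ker v)
      where
      onComponent : ∀ {u} → Dec (Connected H v u) → Carrier
      onComponent {u} (yes _) = signed (colour u)
      onComponent     (no  _) = 0#

      x : Fin n → Carrier
      x u = onComponent (v⇝? u)

      nonzero : (v⇝v? : Dec (Connected H v v)) → ¬ onComponent v⇝v? ≈ 0#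
      nonzero (yes _)   xv≈0 = 1≉0 (≈±-zero (signed-≈±1 (colour v)) xv≈0)
      nonzero (no v⇝̸v) _    = v⇝̸v ε

      x∈ker : InKernel H x
      x∈ker (single j) e∈H with v⇝? j
      ... | yes v⇝j = ⊥-elim (proper _ e∈H (j , v⇝j , refl))
      ... | no  _   = ≈-refl
      x∈ker e@(pair j k _) e∈H with v⇝? j | v⇝? k
      ... | yes v⇝j | yes _   = signed-opposite (proper e e∈H (j , v⇝j , inj₁ refl))
      ... | yes v⇝j | no v⇝̸k = ⊥-elim (v⇝̸k (v⇝j ◅◅ ((e , e∈H , inj₁ refl , inj₂ refl) ◅ ε)))
      ... | no v⇝̸j | yes v⇝k = ⊥-elim (v⇝̸j (v⇝k ◅◅ ((e , e∈H , inj₂ refl , inj₁ refl) ◅ ε)))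
      ... | no _    | no _    = +-identityʳ 0#

  module _ (_≟_ : ∀ a b → Dec (a ≈ b)) (1≉0 : ¬ 1# ≈ 0#)
           (2-torsionFree : ∀ a → a + a ≈ 0# → a ≈ 0#) {n} (H : Scheme n) where

    TrivialKernel⇔noBipartiteComponent : TrivialKernel H ⇔ (∀ v → ¬ ComponentBipartite H v)
    TrivialKernel⇔noBipartiteComponent = mk⇔
      (λ trivial v bipartite → ComponentBipartite⇒¬TrivialKernel 1≉0 H v bipartite trivial)
      noBipartite⇒trivial
      where
      noBipartite⇒trivial : (∀ v → ¬ ComponentBipartite H v) → TrivialKernel H
      noBipartite⇒trivial noBipartite x x∈ker v with x v ≟ 0#
      ... | yes xv≈0 = xv≈0
      ... | no  xv≉0 = ⊥-elim (noBipartite v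
              (nonzeroKernelVector⇒ComponentBipartite x∈ker _≟_ 2-torsionFree xv≉0))

module _ (F : CommutativeRing 0ℓ 0ℓ) (F-isField : IsField F) where
  open CommutativeRing F hiding (zero)
  open import Relation.Binary.Reasoning.Setoid setoid
  open AbelianGroupProperties +-abelianGroup using (identityʳ-unique)

  1≉0 : ¬ 1# ≈ 0#
  1≉0 = proj₁ F-isField ∘ sym

  x*y≈0⇒x≈0 : ∀ {x y} → x * y ≈ 0# → ¬ y ≈ 0# → x ≈ 0#
  x*y≈0⇒x≈0 {x} {y} xy≈0 y≉0 with proj₂ F-isField y y≉0
  ... | y⁻¹ , yy⁻¹≈1 = begin
    x              ≈⟨ *-identityʳ x ⟨
    x * 1#         ≈⟨ *-congˡ yy⁻¹≈1 ⟨
    x * (y * y⁻¹)  ≈⟨ *-assoc x y y⁻¹ ⟨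
    (x * y) * y⁻¹  ≈⟨ *-congʳ xy≈0 ⟩
    0# * y⁻¹       ≈⟨ zeroˡ y⁻¹ ⟩
    0#             ∎

  2-torsionFree : ¬ 1# + 1# ≈ 0# → ∀ a → a + a ≈ 0# → a ≈ 0#
  2-torsionFree 2≉0 a a+a≈0 = x*y≈0⇒x≈0 (begin
    a * (1# + 1#)     ≈⟨ distribˡ a 1# 1# ⟩
    a * 1# + a * 1#   ≈⟨ +-cong (*-identityʳ a) (*-identityʳ a) ⟩
    a + a             ≈⟨ a+a≈0 ⟩
    0#                ∎) 2≉0

  -- If 1 + 1 = 0 then x ↦ x + 1 is a fixed-point-free involution of the carrier.
  odd-cardinality⇒1+1≉0 : ∀ {q} → HasCardinality F q → IsOdd q → ¬ 1# + 1# ≈ 0#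
  odd-cardinality⇒1+1≉0 {q} card odd 2≈0 = ℕ.0≢1+n (≡.trans (≡.sym
    (fixedPointFreeInvolution⇒even q successor successor-involutive successor-fixedPointFree)) odd)
    where
    open Inverse card
    successor : Fin q → Fin q
    successor i = to (from i + 1#)

    successor-involutive : ∀ i → successor (successor i) ≡ i
    successor-involutive i = ≡.trans (to-cong (begin
      from (to (from i + 1#)) + 1#  ≈⟨ +-congʳ (strictlyInverseʳ _) ⟩
      (from i + 1#) + 1#            ≈⟨ +-assoc _ _ _ ⟩
      from i + (1# + 1#)            ≈⟨ +-congˡ 2≈0 ⟩
      from i + 0#                   ≈⟨ +-identityʳ _ ⟩
      from i                        ∎)) (strictlyInverseˡ i)

    successor-fixedPointFree : ∀ i → successor i ≢ i
    successor-fixedPointFree i eq = 1≉0 (identityʳ-unique (from i) 1# (begin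
      from i + 1#                   ≈⟨ strictlyInverseʳ _ ⟨
      from (successor i)            ≡⟨ cong from eq ⟩
      from i                        ∎))

corollary1 : (q : ℕ) → IsPrimePower q → IsOdd q →
    (F : CommutativeRing 0ℓ 0ℓ) → IsGF F q →
    (ℓ : ℕ) → ℓ ≥ 1 →
    (n : ℕ) → n ≥ 2 →
    (G H : Scheme n) → H ⊆ G →
    Decodable F ℓ H ⇔ (∀ v → ¬ ComponentBipartite H v × ¬ ComponentIsolated H v)
corollary1 q _ odd F (F-isField , card) (suc ℓ) _ n _ G H _ = mk⇔
  (λ decodable v → let ¬bipartite = to decodable⇔noBipartite decodable v in
     ¬bipartite , ¬bipartite ∘ ComponentIsolated⇒ComponentBipartite H v)
  (λ components → from decodable⇔noBipartite (proj₁ ∘ components))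
  where
  open Equivalence

  decodable⇔noBipartite : Decodable F (suc ℓ) H ⇔ (∀ v → ¬ ComponentBipartite H v)
  decodable⇔noBipartite = ⇔-trans (Decodable⇔TrivialKernel F ℓ H)
    (TrivialKernel⇔noBipartiteComponent F (inj⇒≟ (Inverse⇒Injection card))
      (1≉0 F F-isField) (2-torsionFree F F-isField (odd-cardinality⇒1+1≉0 F F-isField card odd)) H)
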